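{- Let $c$ be a complete history with a linearization witness $\mathit{Match}$. Then the induced enq-order $\ll_{c,\mathit{Match}}$ is a (strict) partial order on $\mathrm{Enq}(c)$; in particular there is no $e\in\mathrm{Enq}(c)$ with $e\ll_{c,\mathit{Match}}e$.
   Context: A queue event is a tuple $(u,m,d_{in},d_{out})$ with unique identifier $u$, $m\in\{\mathtt{enq},\mathtt{deq}\}$; enqueue events carry a value in $\mathbb{N}$, dequeue events return a value in $\mathbb{N}\cup\{\mathtt{NULL}\}$. Each event $a$ has an invocation action $\mathit{inv}(a)$ and a response action $\mathit{res}(a)$. A history is a finite sequence of such actions, each occurring at most once, with each response after its invocation; it is complete if every invoked event has its response. For complete $c$: $\mathrm{Enq}(c)$, $\mathrm{Deq}(c)$ are its enqueue/dequeue events; $\mathrm{Val}(c,e)$ the value enqueued or returned; $e\prec_c e'$ iff $\mathit{res}(e)$ occurs before $\mathit{inv}(e')$; $\mathrm{Before}(c,e)=\{e'\mid e'\prec_c e\}$. A total map $\mathit{Match}:\mathrm{Deq}(c)\to\mathrm{Enq}(c)\cup\{\bot\}$ is safe if (1) $\mathit{Match}(d)\neq\bot$ implies $\mathrm{Val}(c,d)=\mathrm{Val}(c,\mathit{Match}(d))$; (2) $\mathit{Match}(d)=\bot$ iff $\mathrm{Val}(c,d)=\mathtt{NULL}$; (3) $\mathit{Match}(d)=\mathit{Match}(d')\neq\bot$ implies $d=d'$. It is ordered if moreover (1) $d\not\prec_c\mathit{Match}(d)$; (2) whenever $e\prec_c\mathit{Match}(d')$ there is $d$ with $\mathit{Match}(d)=e$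 and $d'\not\prec_c d$. For $d_\bot$ with $\mathrm{Val}(c,d_\bot)=\mathtt{NULL}$: $\mathrm{Bad}_0=\{e\in\mathrm{Enq}(c)\mid d_\bot\prec_c e\lor\forall d.\ \mathit{Match}(d)=e\Rightarrow d_\bot\prec_c d\}$, $\mathrm{Bad}_{i+1}=\{e\in\mathrm{Enq}(c)\mid\exists e_i\in\mathrm{Bad}_i.\ e_i\prec_c e\lor\exists d.\ \mathit{Match}(d)=e\wedge e_i\prec_c d\}$, $\mathrm{Bad}(c,d_\bot)=\bigcup_i\mathrm{Bad}_i$. An ordered map is a linearization witness if $\mathrm{Bad}(c,d)\cap\mathrm{Before}(c,d)=\emptyset$ for every $d\in\mathrm{Deq}(c)$ with $\mathrm{Val}(c,d)=\mathtt{NULL}$. Two events $a,a'$ overlap if neither $a\prec_c a'$ nor $a'\prec_c a$. For $e_1\neq e_2$ in $\mathrm{Enq}(c)$, $e_1\ll^1 e_2$ holds if one of: (1) $e_1\prec_c e_2$; (2) $e_1,e_2$ overlap, some $d_1$ has $\mathit{Match}(d_1)=e_1$, and no $d_2$ has $\mathit{Match}(d_2)=e_2$; (3) $e_1,e_2$ overlap and there are $d_1,d_2$ with $\mathit{Match}(d_i)=e_i$ and $d_1\prec_c d_2$; (4) $e_1,e_2$ overlap, there are $d_1,d_2$ with $\mathit{Match}(d_i)=e_i$, and there is $d\in\mathrm{Deq}(c)$ with $\mathrm{Val}(c,d)=\mathtt{NULL}$, $e_1\notin\mathrm{Bad}(c,d)$, $e_2\in\mathrm{Bad}(c,d)$.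 The enq-order $\ll_{c,\mathit{Match}}$ is the transitive closure of $\ll^1$. -}

module Defs where

open import Data.Nat using (ℕ)
open import Data.Maybe using (Maybe; just; nothing)
open import Data.List using (List; _∷_; [_]; _++_)
open import Data.List.Membership.Propositional using (_∈_)
open import Data.List.Relation.Unary.Unique.Propositional using (Unique)
open import Data.Product using (Σ; ∃; _×_; _,_)
open import Data.Empty using (⊥)
open import Data.Unit using (⊤)
open import Relation.Nullary using (¬_)
open import Relation.Binary.PropositionalEquality using (_≡_)
open import Relation.Binary.Construct.Closure.Transitive using (TransClosure)

-- The method of a queue event together with its data:
--   enq v       : enqueue of value v   (d_in = v)
--   deq r       : dequeue returning r, where r = nothing encodes NULL
data Op : Set where
  enq : ℕ → Op
  deq : Maybe ℕ → Op

record Event : Set where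
  constructor event
  field
    uid : ℕ
    op  : Op
open Event public

data Action : Set where
  inv : Event → Action
  res : Event → Action

History : Set
History = List Action

_⊢_before_ : History → Action → Action → Set
c ⊢ a before b = ∃ λ xs → ∃ λ ys → ∃ λ zs → c ≡ xs ++ (a ∷ ys) ++ (b ∷ zs)

record IsHistory (c : History) : Set where
  field
    unique    : Unique c
    resAfter  : ∀ e → res e ∈ c → c ⊢ inv e before res e
    uidUnique : ∀ e e' → inv e ∈ c → inv e' ∈ c → uid e ≡ uid e' → e ≡ e'

record IsComplete (c : History) : Set where
  field
    isHistory : IsHistory c
    complete  : ∀ e → inv e ∈ c → res e ∈ c

InC : History → Event → Set
InC c e = inv e ∈ c

IsEnqOp : Op → Set
IsEnqOp (enq _) = ⊤
IsEnqOp (deq _) = ⊥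

IsDeqOp : Op → Set
IsDeqOp (enq _) = ⊥
IsDeqOp (deq _) = ⊤

InEnq : History → Event → Set
InEnq c e = InC c e × IsEnqOp (op e)

InDeq : History → Event → Set
InDeq c e = InC c e × IsDeqOp (op e)

Val : Event → Maybe ℕ
Val e with op e
... | enq v = just v
... | deq r = r

_⊢_≺_ : History → Event → Event → Set
c ⊢ e ≺ e' = c ⊢ res e before inv e'

Overlap : History → Event → Event → Set
Overlap c a a' = ¬ (c ⊢ a ≺ a') × ¬ (c ⊢ a' ≺ a)

-- A map Match : Deq(c) → Enq(c) ∪ {⊥}; ⊥ is encoded by nothing.
-- Values of the function outside Deq(c) are irrelevant.
MatchFn : Set
MatchFn = Event → Maybe Event

record IsMap (c : History) (M : MatchFn) : Set where
  field
    into : ∀ d e → InDeq c d → M d ≡ just e → InEnq c e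

record IsSafe (c : History) (M : MatchFn) : Set where
  field
    isMap  : IsMap c M
    sameVal : ∀ d e → InDeq c d → M d ≡ just e → Val d ≡ Val e
    botNull : ∀ d → InDeq c d → (M d ≡ nothing → Val d ≡ nothing)
                               × (Val d ≡ nothing → M d ≡ nothing)
    inj    : ∀ d d' e → InDeq c d → InDeq c d' → M d ≡ just e → M d' ≡ just e → d ≡ d'

record IsOrdered (c : History) (M : MatchFn) : Set where
  field
    isSafe : IsSafe c M
    ord1   : ∀ d e → InDeq c d → M d ≡ just e → ¬ (c ⊢ d ≺ e)
    ord2   : ∀ e d' e' → InEnq c e → InDeq c d' → M d' ≡ just e' → c ⊢ e ≺ e' →
             ∃ λ d → InDeq c d × M d ≡ just e × ¬ (c ⊢ d' ≺ d)

-- Bad(c, d⊥) = ⋃ᵢ Badᵢ, as the inductive closure of the Badᵢ rules.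
data Bad (c : History) (M : MatchFn) (dbot : Event) : Event → Set where
  bad0-prec  : ∀ {e} → InEnq c e → c ⊢ dbot ≺ e → Bad c M dbot e
  bad0-match : ∀ {e} → InEnq c e →
               (∀ d → InDeq c d → M d ≡ just e → c ⊢ dbot ≺ d) → Bad c M dbot e
  badS-prec  : ∀ {e ei} → InEnq c e → Bad c M dbot ei → c ⊢ ei ≺ e → Bad c M dbot e
  badS-match : ∀ {e ei} d → InEnq c e → Bad c M dbot ei →
               InDeq c d → M d ≡ just e → c ⊢ ei ≺ d → Bad c M dbot e

record IsLinWitness (c : History) (M : MatchFn) : Set where
  field
    isOrdered : IsOrdered c M
    noBadBefore : ∀ d → InDeq c d → Val d ≡ nothing →
                  ∀ e → Bad c M d e → ¬ (c ⊢ e ≺ d)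

data EnqOrder1 (c : History) (M : MatchFn) (e₁ e₂ : Event) : Set where
  r1 : InEnq c e₁ → InEnq c e₂ → ¬ (e₁ ≡ e₂) → c ⊢ e₁ ≺ e₂ → EnqOrder1 c M e₁ e₂
  r2 : InEnq c e₁ → InEnq c e₂ → ¬ (e₁ ≡ e₂) → Overlap c e₁ e₂ →
       (∃ λ d₁ → InDeq c d₁ × M d₁ ≡ just e₁) →
       ¬ (∃ λ d₂ → InDeq c d₂ × M d₂ ≡ just e₂) → EnqOrder1 c M e₁ e₂
  r3 : InEnq c e₁ → InEnq c e₂ → ¬ (e₁ ≡ e₂) → Overlap c e₁ e₂ →
       ∀ d₁ d₂ → InDeq c d₁ → InDeq c d₂ → M d₁ ≡ just e₁ → M d₂ ≡ just e₂ →
       c ⊢ d₁ ≺ d₂ → EnqOrder1 c M e₁ e₂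
  r4 : InEnq c e₁ → InEnq c e₂ → ¬ (e₁ ≡ e₂) → Overlap c e₁ e₂ →
       ∀ d₁ d₂ → InDeq c d₁ → InDeq c d₂ → M d₁ ≡ just e₁ → M d₂ ≡ just e₂ →
       ∀ d → InDeq c d → Val d ≡ nothing → ¬ Bad c M d e₁ → Bad c M d e₂ →
       EnqOrder1 c M e₁ e₂

EnqOrder : History → MatchFn → Event → Event → Set
EnqOrder c M = TransClosure (EnqOrder1 c M)

-- Every ≪¹-step x → y propagates badness: x ∈ Bad(d) implies y ∈ Bad(d), for every d.
-- The Bad sets are moreover nested (if e ∈ Bad(d') ∖ Bad(d) then Bad(d) ⊆ Bad(d')),
-- so a rule-(4) step strictly enlarges the family of Bad sets containing its endpoint.
-- Steps by rules (1)–(3) stay inside the transitive closure of real-time order ≺,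
-- dequeue order ≺ᵈ, and the relation "y is unmatched while x is matched or x ≺ y",
-- which is acyclic: ≺ is an interval order and the FIFO condition forbids x ≺ y
-- together with y ≺ᵈ x, which collapses every word in ≺ and ≺ᵈ to one of ≺, ≺ᵈ, ≺≺ᵈ, ≺ᵈ≺.
-- Hence ≪ is contained in a strict order.
module Submission where

open import Defs
import Data.Nat as ℕ
open import Data.Maybe using (just)
open import Data.Maybe.Properties using (≡-dec)
open import Data.List using (List; []; _∷_; _++_)
open import Data.List.Membership.Propositional using (_∈_)
open import Data.List.Membership.Propositional.Properties using (∈-∃++; ∈-++⁺ʳ)
open import Data.List.Relation.Unary.Any using (here; there; any?)
open import Data.List.Relation.Unary.All using () renaming (lookup to All-lookup)
open import Data.List.Relation.Unary.AllPairs using (_∷_)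
open import Data.List.Relation.Unary.Unique.Propositional using (Unique)
open import Data.Product using (∃; ∃₂; _×_; _,_; proj₁; proj₂)
open import Data.Sum using (_⊎_; inj₁; inj₂; [_,_]′; map; map₂)
open import Function using (id; _∘_)
open import Relation.Nullary using (¬_; Dec; yes; no; contradiction)
open import Relation.Nullary.Decidable using (map′; _×-dec_; _⊎-dec_)
open import Relation.Binary.Definitions using (DecidableEquality)
open import Relation.Binary.PropositionalEquality
  using (_≡_; refl; cong; cong₂; subst; isEquivalence; resp₂)
open import Relation.Binary.Structures using (IsStrictPartialOrder)
open import Relation.Binary.Construct.Closure.Transitive using ([_]; _∷_; transitive)

_≟ᵒ_ : DecidableEquality Op
enq m ≟ᵒ enq n = map′ (cong enq) (λ { refl → refl }) (m ℕ.≟ n)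
deq r ≟ᵒ deq s = map′ (cong deq) (λ { refl → refl }) (≡-dec ℕ._≟_ r s)
enq _ ≟ᵒ deq _ = no λ ()
deq _ ≟ᵒ enq _ = no λ ()

_≟ᵉ_ : DecidableEquality Event
event u o ≟ᵉ event u' o' =
  map′ (λ (p , q) → cong₂ event p q) (λ { refl → refl , refl }) (u ℕ.≟ u' ×-dec o ≟ᵒ o')

_≟ᵃ_ : DecidableEquality Action
inv e ≟ᵃ inv e' = map′ (cong inv) (λ { refl → refl }) (e ≟ᵉ e')
res e ≟ᵃ res e' = map′ (cong res) (λ { refl → refl }) (e ≟ᵉ e')
inv _ ≟ᵃ res _ = no λ ()
res _ ≟ᵃ inv _ = no λ ()

module _ {A : Set} where

  data Precedes : List A → A → A → Set where
    now   : ∀ {x y xs} → y ∈ xs → Precedes (x ∷ xs) x y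
    later : ∀ {z x y xs} → Precedes xs x y → Precedes (z ∷ xs) x y

  Precedes⇒∈ˡ : ∀ {xs x y} → Precedes xs x y → x ∈ xs
  Precedes⇒∈ˡ (now _)   = here refl
  Precedes⇒∈ˡ (later p) = there (Precedes⇒∈ˡ p)

  Precedes⇒∈ʳ : ∀ {xs x y} → Precedes xs x y → y ∈ xs
  Precedes⇒∈ʳ (now y∈)  = there y∈
  Precedes⇒∈ʳ (later p) = there (Precedes⇒∈ʳ p)

  Before : List A → A → A → Set
  Before xs x y = ∃ λ ps → ∃ λ qs → ∃ λ rs → xs ≡ ps ++ (x ∷ qs) ++ (y ∷ rs)

  Before⇒Precedes : ∀ {xs x y} → Before xs x y → Precedes xs x y
  Before⇒Precedes {x = x} {y} (ps , qs , rs , refl) = go ps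
    where
    go : ∀ ps → Precedes (ps ++ (x ∷ qs) ++ (y ∷ rs)) x y
    go []       = now (∈-++⁺ʳ qs (here refl))
    go (_ ∷ ps) = later (go ps)

  Precedes⇒Before : ∀ {xs x y} → Precedes xs x y → Before xs x y
  Precedes⇒Before (now y∈) with qs , rs , eq ← ∈-∃++ y∈ = [] , qs , rs , cong (_ ∷_) eq
  Precedes⇒Before (later p) with ps , qs , rs , eq ← Precedes⇒Before p =
    _ ∷ ps , qs , rs , cong (_ ∷_) eq

  Precedes-asym : ∀ {xs x y} → Unique xs → Precedes xs x y → ¬ Precedes xs y x
  Precedes-asym (x∉ ∷ _) (now _)   (now x∈)  = All-lookup x∉ x∈ refl
  Precedes-asym (y∉ ∷ _) (now _)   (later q) = All-lookup y∉ (Precedes⇒∈ʳ q) refl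
  Precedes-asym (x∉ ∷ _) (later p) (now _)   = All-lookup x∉ (Precedes⇒∈ʳ p) refl
  Precedes-asym (_ ∷ u)  (later p) (later q) = Precedes-asym u p q

  Precedes-interval : ∀ {xs a b a' b'} → Precedes xs a b → Precedes xs a' b' →
                      Precedes xs a b' ⊎ Precedes xs a' b
  Precedes-interval (now _)   (now b'∈) = inj₁ (now b'∈)
  Precedes-interval (now _)   (later q) = inj₁ (now (Precedes⇒∈ʳ q))
  Precedes-interval (later p) (now _)   = inj₂ (now (Precedes⇒∈ʳ p))
  Precedes-interval (later p) (later q) = [ inj₁ ∘ later , inj₂ ∘ later ]′ (Precedes-interval p q)

  Precedes? : DecidableEquality A → ∀ xs x y → Dec (Precedes xs x y)
  Precedes? _≟_ []       x y = no λ ()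
  Precedes? _≟_ (z ∷ xs) x y =
    map′ [ (λ { (refl , y∈) → now y∈ }) , later ]′
         (λ { (now y∈) → inj₁ (refl , y∈) ; (later p) → inj₂ p })
         ((x ≟ z ×-dec any? (y ≟_) xs) ⊎-dec Precedes? _≟_ xs x y)

module RealTime (c : History) (h : IsHistory c) where
  open IsHistory h

  _≺_ : Event → Event → Set
  a ≺ b = c ⊢ a ≺ b

  ≺-irrefl : ∀ {a} → ¬ a ≺ a
  ≺-irrefl {a} a≺a = Precedes-asym unique p (Before⇒Precedes (resAfter a (Precedes⇒∈ˡ p)))
    where p = Before⇒Precedes a≺a

  ≺-interval : ∀ {a b a' b'} → a ≺ b → a' ≺ b' → ¬ a' ≺ b → a ≺ b'
  ≺-interval a≺b a'≺b' ¬a'≺b =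
    [ Precedes⇒Before , (λ a'≺b → contradiction (Precedes⇒Before a'≺b) ¬a'≺b) ]′
      (Precedes-interval (Before⇒Precedes a≺b) (Before⇒Precedes a'≺b'))

  ≺-trans : ∀ {a b d} → a ≺ b → b ≺ d → a ≺ d
  ≺-trans a≺b b≺d = ≺-interval a≺b b≺d ≺-irrefl

  _≺?_ : ∀ a b → Dec (a ≺ b)
  a ≺? b = map′ Precedes⇒Before Before⇒Precedes (Precedes? _≟ᵃ_ c (res a) (inv b))

module OrderedMatch (c : History) (M : MatchFn) (h : IsHistory c) (O : IsOrdered c M) where
  open RealTime c h
  open IsOrdered O
  open IsSafe isSafe
  open IsMap isMap

  Dequeues : Event → Event → Set
  Dequeues d e = InDeq c d × M d ≡ just e

  Matched : Event → Set
  Matched e = ∃ λ d → Dequeues d e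

  Dequeues-injective : ∀ {d d' e} → Dequeues d e → Dequeues d' e → d ≡ d'
  Dequeues-injective (d∈ , m) (d'∈ , m') = inj _ _ _ d∈ d'∈ m m'

  Dequeues⇒InEnq : ∀ {d e} → Dequeues d e → InEnq c e
  Dequeues⇒InEnq (d∈ , m) = into _ _ d∈ m

  Dequeues-¬≺ : ∀ {d e} → Dequeues d e → ¬ d ≺ e
  Dequeues-¬≺ (d∈ , m) = ord1 _ _ d∈ m

  Matched-≺ : ∀ {x y} → InEnq c x → x ≺ y → Matched y → Matched x
  Matched-≺ x∈ x≺y (d , d∈ , m) with d' , d'∈ , m' , _ ← ord2 _ d _ x∈ d∈ m x≺y = d' , d'∈ , m'

  _≺ᵈ_ : Event → Event → Set
  x ≺ᵈ y = ∃₂ λ d₁ d₂ → Dequeues d₁ x × Dequeues d₂ y × d₁ ≺ d₂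

  ≺ᵈ⇒Matched : ∀ {x y} → x ≺ᵈ y → Matched x
  ≺ᵈ⇒Matched (d₁ , _ , D₁ , _) = d₁ , D₁

  ≺ᵈ-irrefl : ∀ {x} → ¬ x ≺ᵈ x
  ≺ᵈ-irrefl (d₁ , d₂ , D₁ , D₂ , d₁≺d₂) = ≺-irrefl (subst (d₁ ≺_) (Dequeues-injective D₂ D₁) d₁≺d₂)

  ≺ᵈ-trans : ∀ {x y z} → x ≺ᵈ y → y ≺ᵈ z → x ≺ᵈ z
  ≺ᵈ-trans (d₁ , d₂ , D₁ , D₂ , d₁≺d₂) (d₂' , d₃ , D₂' , D₃ , d₂'≺d₃) =
    d₁ , d₃ , D₁ , D₃ , ≺-trans d₁≺d₂ (subst (_≺ d₃) (Dequeues-injective D₂' D₂) d₂'≺d₃)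

  ≺-≺ᵈ-asym : ∀ {x y} → x ≺ y → ¬ y ≺ᵈ x
  ≺-≺ᵈ-asym x≺y (dy , dx , (dy∈ , my) , Dx , dy≺dx)
    with d , d∈ , m , ¬dy≺d ← ord2 _ dy _ (Dequeues⇒InEnq Dx) dy∈ my x≺y =
    ¬dy≺d (subst (dy ≺_) (Dequeues-injective Dx (d∈ , m)) dy≺dx)

  ≺-≺ᵈ-≺ : ∀ {x y z w} → x ≺ y → y ≺ᵈ z → z ≺ w → x ≺ w
  ≺-≺ᵈ-≺ x≺y y≺ᵈz z≺w = ≺-interval x≺y z≺w (λ z≺y → ≺-≺ᵈ-asym z≺y y≺ᵈz)

  ≺ᵈ-≺-≺ᵈ : ∀ {x y z w} → x ≺ᵈ y → y ≺ z → z ≺ᵈ w → x ≺ᵈ w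
  ≺ᵈ-≺-≺ᵈ (dx , dy , Dx , Dy , dx≺dy) y≺z (dz , dw , Dz , Dw , dz≺dw) =
    dx , dw , Dx , Dw , ≺-interval dx≺dy dz≺dw (λ dz≺dy → ≺-≺ᵈ-asym y≺z (dz , dy , Dz , Dy , dz≺dy))

  -- The transitive closure of ≺ ∪ ≺ᵈ: by ≺-≺ᵈ-≺ and ≺ᵈ-≺-≺ᵈ every word reduces to one of these.
  data _⊏_ (x y : Event) : Set where
    rt    : x ≺ y → x ⊏ y
    dq    : x ≺ᵈ y → x ⊏ y
    rt-dq : ∀ {m} → x ≺ m → m ≺ᵈ y → x ⊏ y
    dq-rt : ∀ {m} → x ≺ᵈ m → m ≺ y → x ⊏ y

  ⊏-trans : ∀ {x y z} → x ⊏ y → y ⊏ z → x ⊏ z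
  ⊏-trans (rt p)      (rt q)      = rt (≺-trans p q)
  ⊏-trans (rt p)      (dq q)      = rt-dq p q
  ⊏-trans (rt p)      (rt-dq q r) = rt-dq (≺-trans p q) r
  ⊏-trans (rt p)      (dq-rt q r) = rt (≺-≺ᵈ-≺ p q r)
  ⊏-trans (dq p)      (rt q)      = dq-rt p q
  ⊏-trans (dq p)      (dq q)      = dq (≺ᵈ-trans p q)
  ⊏-trans (dq p)      (rt-dq q r) = dq (≺ᵈ-≺-≺ᵈ p q r)
  ⊏-trans (dq p)      (dq-rt q r) = dq-rt (≺ᵈ-trans p q) r
  ⊏-trans (rt-dq p q) (rt r)      = rt (≺-≺ᵈ-≺ p q r)
  ⊏-trans (rt-dq p q) (dq r)      = rt-dq p (≺ᵈ-trans q r)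
  ⊏-trans (rt-dq p q) (rt-dq r s) = rt-dq (≺-≺ᵈ-≺ p q r) s
  ⊏-trans (rt-dq p q) (dq-rt r s) = rt (≺-≺ᵈ-≺ p (≺ᵈ-trans q r) s)
  ⊏-trans (dq-rt p q) (rt r)      = dq-rt p (≺-trans q r)
  ⊏-trans (dq-rt p q) (dq r)      = dq (≺ᵈ-≺-≺ᵈ p q r)
  ⊏-trans (dq-rt p q) (rt-dq r s) = dq (≺ᵈ-≺-≺ᵈ p (≺-trans q r) s)
  ⊏-trans (dq-rt p q) (dq-rt r s) = dq-rt (≺ᵈ-≺-≺ᵈ p q r) s

  ⊏-irrefl : ∀ {x} → ¬ x ⊏ x
  ⊏-irrefl (rt p)      = ≺-irrefl p
  ⊏-irrefl (dq p)      = ≺ᵈ-irrefl p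
  ⊏-irrefl (rt-dq p q) = ≺-≺ᵈ-asym p q
  ⊏-irrefl (dq-rt p q) = ≺-≺ᵈ-asym q p

  ⊏-source : ∀ {x y} → InEnq c x → x ⊏ y → Matched x ⊎ x ≺ y
  ⊏-source x∈ (rt p)      = inj₂ p
  ⊏-source x∈ (dq p)      = inj₁ (≺ᵈ⇒Matched p)
  ⊏-source x∈ (rt-dq p q) = inj₁ (Matched-≺ x∈ p (≺ᵈ⇒Matched q))
  ⊏-source x∈ (dq-rt p _) = inj₁ (≺ᵈ⇒Matched p)

  _≺ᵘ_ : Event → Event → Set
  x ≺ᵘ y = ¬ Matched y × (Matched x ⊎ x ≺ y)

  ≺ᵘ-extend : ∀ {x y z} → InEnq c y → x ≺ᵘ y → Matched y ⊎ y ≺ z → x ≺ᵘ z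
  ≺ᵘ-extend y∈ (¬my , x-src) (inj₁ my)  = contradiction my ¬my
  ≺ᵘ-extend y∈ (¬my , x-src) (inj₂ y≺z) =
    ¬my ∘ Matched-≺ y∈ y≺z , map₂ (λ x≺y → ≺-trans x≺y y≺z) x-src

  ⊏-≺ᵘ : ∀ {x y z} → InEnq c x → x ⊏ y → y ≺ᵘ z → x ≺ᵘ z
  ⊏-≺ᵘ x∈ p (¬mz , y-src) =
    ¬mz , [ inj₁ , (λ x≺y → map (Matched-≺ x∈ x≺y) (≺-trans x≺y) y-src) ]′ (⊏-source x∈ p)

  _◁_ : Event → Event → Set
  x ◁ y = x ⊏ y ⊎ x ≺ᵘ y

  ◁-trans : ∀ {x y z} → InEnq c x → InEnq c y → x ◁ y → y ◁ z → x ◁ z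
  ◁-trans x∈ y∈ (inj₁ p) (inj₁ q) = inj₁ (⊏-trans p q)
  ◁-trans x∈ y∈ (inj₁ p) (inj₂ q) = inj₂ (⊏-≺ᵘ x∈ p q)
  ◁-trans x∈ y∈ (inj₂ p) (inj₁ q) = inj₂ (≺ᵘ-extend y∈ p (⊏-source y∈ q))
  ◁-trans x∈ y∈ (inj₂ p) (inj₂ q) = inj₂ (≺ᵘ-extend y∈ p (proj₂ q))

  ◁-irrefl : ∀ {x} → ¬ x ◁ x
  ◁-irrefl (inj₁ p)               = ⊏-irrefl p
  ◁-irrefl (inj₂ (¬mx , inj₁ mx)) = ¬mx mx
  ◁-irrefl (inj₂ (_ , inj₂ x≺x))  = ≺-irrefl x≺x

  Bad₀ : Event → Event → Set
  Bad₀ D e = D ≺ e ⊎ (∀ d → InDeq c d → M d ≡ just e → D ≺ d)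

  Bad₀⇒Bad : ∀ {D e} → InEnq c e → Bad₀ D e → Bad c M D e
  Bad₀⇒Bad e∈ = [ bad0-prec e∈ , bad0-match e∈ ]′

  Bad-root : ∀ {D e} → Bad c M D e →
             ∃ λ e₀ → InEnq c e₀ × Bad₀ D e₀ × (∀ {D'} → Bad c M D' e₀ → Bad c M D' e)
  Bad-root (bad0-prec e∈ p)  = _ , e∈ , inj₁ p , id
  Bad-root (bad0-match e∈ f) = _ , e∈ , inj₂ f , id
  Bad-root (badS-prec e∈ b p) with e₀ , e₀∈ , b₀ , grow ← Bad-root b =
    e₀ , e₀∈ , b₀ , λ b' → badS-prec e∈ (grow b') p
  Bad-root (badS-match d e∈ b d∈ m p) with e₀ , e₀∈ , b₀ , grow ← Bad-root b =
    e₀ , e₀∈ , b₀ , λ b' → badS-match d e∈ (grow b') d∈ m p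

  Bad₀-nested : ∀ {D D' e x} → ¬ Bad₀ D e → Bad₀ D' e → Bad₀ D x → Bad₀ D' x
  Bad₀-nested ¬b (inj₁ D'≺e) (inj₁ D≺x) = inj₁ (≺-interval D'≺e D≺x (¬b ∘ inj₁))
  Bad₀-nested ¬b (inj₁ D'≺e) (inj₂ g)   = inj₂ λ d d∈ m → ≺-interval D'≺e (g d d∈ m) (¬b ∘ inj₁)
  Bad₀-nested {D' = D'} {x = x} ¬b (inj₂ f) (inj₁ D≺x) with D' ≺? x
  ... | yes D'≺x = inj₁ D'≺x
  ... | no ¬D'≺x = contradiction (inj₂ λ d d∈ m → ≺-interval D≺x (f d d∈ m) ¬D'≺x) ¬b
  Bad₀-nested {D' = D'} ¬b (inj₂ f) (inj₂ g) = inj₂ D'-before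
    where
    D'-before : ∀ d → InDeq c d → M d ≡ just _ → D' ≺ d
    D'-before d d∈ m with D' ≺? d
    ... | yes D'≺d = D'≺d
    ... | no ¬D'≺d = contradiction (inj₂ λ d₁ d₁∈ m₁ → ≺-interval (g d d∈ m) (f d₁ d₁∈ m₁) ¬D'≺d) ¬b

  Bad-nested-base : ∀ {D D' e x} → ¬ Bad c M D e → Bad c M D' e → InEnq c x → Bad₀ D x → Bad c M D' x
  Bad-nested-base ¬b b' x∈ b₀ with e₀ , e₀∈ , b₀' , grow ← Bad-root b' =
    Bad₀⇒Bad x∈ (Bad₀-nested (¬b ∘ grow ∘ Bad₀⇒Bad e₀∈) b₀' b₀)

  Bad-nested : ∀ {D D' e x} → ¬ Bad c M D e → Bad c M D' e → Bad c M D x → Bad c M D' x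
  Bad-nested ¬b b' (bad0-prec x∈ p)           = Bad-nested-base ¬b b' x∈ (inj₁ p)
  Bad-nested ¬b b' (bad0-match x∈ f)          = Bad-nested-base ¬b b' x∈ (inj₂ f)
  Bad-nested ¬b b' (badS-prec x∈ b p)         = badS-prec x∈ (Bad-nested ¬b b' b) p
  Bad-nested ¬b b' (badS-match d x∈ b d∈ m p) = badS-match d x∈ (Bad-nested ¬b b' b) d∈ m p

  Bad-≺ᵈ : ∀ {D x y} → Bad c M D x → x ≺ᵈ y → Bad c M D y
  Bad-≺ᵈ {D} {x} {y} b (d₁ , d₂ , D₁ , D₂ , d₁≺d₂) = propagate b
    where
    y∈ = Dequeues⇒InEnq D₂

    D-before-d₂ : D ≺ d₂ → Bad c M D y
    D-before-d₂ p = bad0-match y∈ λ d d∈ m → subst (D ≺_) (Dequeues-injective D₂ (d∈ , m)) p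

    propagate : Bad c M D x → Bad c M D y
    propagate (bad0-prec _ D≺x) = D-before-d₂ (≺-interval D≺x d₁≺d₂ (Dequeues-¬≺ D₁))
    propagate (bad0-match _ f)  = D-before-d₂ (≺-trans (f d₁ (proj₁ D₁) (proj₂ D₁)) d₁≺d₂)
    propagate (badS-prec _ b' ei≺x) =
      badS-match d₂ y∈ b' (proj₁ D₂) (proj₂ D₂) (≺-interval ei≺x d₁≺d₂ (Dequeues-¬≺ D₁))
    propagate (badS-match d _ b' d∈ m ei≺d) =
      badS-match d₂ y∈ b' (proj₁ D₂) (proj₂ D₂)
        (≺-trans (subst (_ ≺_) (Dequeues-injective (d∈ , m) D₁) ei≺d) d₁≺d₂)

  Unmatched⇒Bad : ∀ {D y} → InEnq c y → ¬ Matched y → Bad c M D y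
  Unmatched⇒Bad y∈ ¬my = bad0-match y∈ λ d d∈ m → contradiction (d , d∈ , m) ¬my

  -- Lexicographic: first the family of Bad sets containing the event grows, then ◁.
  record _⋖_ (x y : Event) : Set where
    field
      enqˡ     : InEnq c x
      enqʳ     : InEnq c y
      Bad-mono : ∀ {D} → Bad c M D x → Bad c M D y
      strict   : (∃ λ D → ¬ Bad c M D x × Bad c M D y) ⊎ x ◁ y
  open _⋖_

  ⋖-trans : ∀ {x y z} → x ⋖ y → y ⋖ z → x ⋖ z
  ⋖-trans {x} {y} {z} p q = record
    { enqˡ = enqˡ p ; enqʳ = enqʳ q ; Bad-mono = Bad-mono q ∘ Bad-mono p
    ; strict = combine (strict p) (strict q) }
    where
    combine : (∃ λ D → ¬ Bad c M D x × Bad c M D y) ⊎ x ◁ y →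
              (∃ λ D → ¬ Bad c M D y × Bad c M D z) ⊎ y ◁ z →
              (∃ λ D → ¬ Bad c M D x × Bad c M D z) ⊎ x ◁ z
    combine (inj₁ (D , ¬bx , by)) _                     = inj₁ (D , ¬bx , Bad-mono q by)
    combine (inj₂ _)              (inj₁ (D , ¬by , bz)) = inj₁ (D , ¬by ∘ Bad-mono p , bz)
    combine (inj₂ x◁y)            (inj₂ y◁z)            = inj₂ (◁-trans (enqˡ p) (enqˡ q) x◁y y◁z)

  ⋖-irrefl : ∀ {x} → ¬ x ⋖ x
  ⋖-irrefl p with strict p
  ... | inj₁ (_ , ¬b , b) = ¬b b
  ... | inj₂ x◁x          = ◁-irrefl x◁x

  ≪¹⇒⋖ : ∀ {x y} → EnqOrder1 c M x y → x ⋖ y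
  ≪¹⇒⋖ (r1 x∈ y∈ _ x≺y) = record
    { enqˡ = x∈ ; enqʳ = y∈ ; Bad-mono = λ b → badS-prec y∈ b x≺y ; strict = inj₂ (inj₁ (rt x≺y)) }
  ≪¹⇒⋖ (r2 x∈ y∈ _ _ mx ¬my) = record
    { enqˡ = x∈ ; enqʳ = y∈ ; Bad-mono = λ _ → Unmatched⇒Bad y∈ ¬my ; strict = inj₂ (inj₂ (¬my , inj₁ mx)) }
  ≪¹⇒⋖ (r3 x∈ y∈ _ _ d₁ d₂ d₁∈ d₂∈ m₁ m₂ d₁≺d₂) = record
    { enqˡ = x∈ ; enqʳ = y∈ ; Bad-mono = λ b → Bad-≺ᵈ b x≺ᵈy ; strict = inj₂ (inj₁ (dq x≺ᵈy)) }
    where x≺ᵈy = d₁ , d₂ , (d₁∈ , m₁) , (d₂∈ , m₂) , d₁≺d₂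
  ≪¹⇒⋖ (r4 x∈ y∈ _ _ _ _ _ _ _ _ D _ _ ¬bx by) = record
    { enqˡ = x∈ ; enqʳ = y∈ ; Bad-mono = λ b → Bad-nested ¬bx b by ; strict = inj₁ (D , ¬bx , by) }

  ≪⇒⋖ : ∀ {x y} → EnqOrder c M x y → x ⋖ y
  ≪⇒⋖ [ r ]    = ≪¹⇒⋖ r
  ≪⇒⋖ (r ∷ rs) = ⋖-trans (≪¹⇒⋖ r) (≪⇒⋖ rs)

lemma4p6 : (c : History) (M : MatchFn) → IsComplete c → IsLinWitness c M →
    IsStrictPartialOrder _≡_ (EnqOrder c M)
lemma4p6 c M C W = record
  { isEquivalence = isEquivalence
  ; irrefl        = λ { refl x≪x → ⋖-irrefl (≪⇒⋖ x≪x) }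
  ; trans         = transitive (EnqOrder1 c M)
  ; <-resp-≈      = resp₂ (EnqOrder c M)
  }
  where open OrderedMatch c M (IsComplete.isHistory C) (IsLinWitness.isOrdered W)
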